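{- Let $\mathbf{c}=c_0c_1c_2\cdots\in\{0,1\}^{\infty}$ with $c_0=1$. Then $\mathbf{c}$ is ($0$-$1$) apwenian if and only if for all $n\geq 0$, \[c_n\equiv c_{2n+1}+c_{2n+2}\pmod 2.\]
   Context: For an integer sequence $\mathbf{a}$, $H_n(\mathbf{a})=\det(a_{i+j})_{0\leq i,j\leq n-1}$. A sequence $\mathbf{c}\in\{0,1\}^{\infty}$ is called ($0$-$1$) apwenian if $H_n(\mathbf{c})\equiv 1\pmod 2$ for all $n\geq 1$. -}

module Defs where

open import Data.Nat using (ℕ; zero; suc; _+_; _*_)
open import Data.Bool using (Bool; true; false)
open import Data.Fin using (Fin; zero; suc; toℕ; punchIn)
open import Data.Integer as ℤ using (ℤ; +_; -_)
open import Data.Integer.DivMod using (_%ℕ_)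
open import Relation.Binary.PropositionalEquality using (_≡_)

bit : Bool → ℤ
bit true  = + 1
bit false = + 0

sgn : ℕ → ℤ
sgn zero = + 1
sgn (suc zero) = - (+ 1)
sgn (suc (suc i)) = sgn i

minor : ∀ {n} → (Fin (suc n) → Fin (suc n) → ℤ) → Fin (suc n) → Fin n → Fin n → ℤ
minor M j r s = M (suc r) (punchIn j s)

sumFin : ∀ n → (Fin n → ℤ) → ℤ
sumFin zero f = + 0
sumFin (suc n) f = f zero ℤ.+ sumFin n (λ i → f (suc i))

det : ∀ n → (Fin n → Fin n → ℤ) → ℤ
det zero M = + 1
det (suc n) M = sumFin (suc n) (λ j → sgn (toℕ j) ℤ.* M zero j ℤ.* det n (minor M j))

H : ℕ → (ℕ → ℤ) → ℤ
H n a = det n (λ i j → a (toℕ i + toℕ j))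

Apwenian : (ℕ → Bool) → Set
Apwenian c = ∀ n → H (suc n) (λ k → bit (c k)) %ℕ 2 ≡ 1

bitℕ : Bool → ℕ
bitℕ true = 1
bitℕ false = 0

module Submission where

-- Everything is read modulo 2: H_n(c) mod 2 is the determinant det₂ over F₂ = (Bool, xor, ∧)
-- of the Hankel matrix (c_{r+s}).
-- Sufficiency: for c with the recurrence, h = c⁻¹ satisfies h_{2j+1} + h_{2j+2} = h_{j+1} + [j = 0],
-- so (h_{j+2})_j has the recurrence again; inductively this gives for every k a polynomial
-- A_k of degree ≤ k, A_k(0) = 1, with c A_k vanishing on [k, 2k) and 1 at 2k.  Column
-- operations with the A_s make the Hankel matrix lower unitriangular.
-- Necessity: the recurrent completion c⁺ of c has all Hankel determinants 1; at the first
-- index 2n where c and c⁺ differ, flipping c_{2n} changes H_{n+1} by H_n, so 1 = 1 + 1.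
-- Finally, the integer determinant of Defs reduces mod 2 to det₂, and the parity
-- condition of the statement is the recurrence.

open import Defs
open import Data.Nat using (ℕ; suc; _+_; _*_; _%_)
open import Data.Bool using (Bool; true)
open import Data.Integer using (+_)
open import Relation.Binary.PropositionalEquality using (_≡_)
open import Function.Bundles using (_⇔_)

open import Data.Nat using (zero; pred; _∸_; _≤_; _<_; z≤n; s≤s; _≟_; _≤?_; ⌊_/2⌋)
open import Data.Nat.Properties
open import Data.Nat.DivMod using ([m+n]%n≡m%n)
open import Data.Nat.Induction using (<-rec)
open import Data.Bool using (false; not; _∧_; _xor_; if_then_else_)
open import Data.Bool.Properties
  using (xor-same; xor-comm; xor-assoc; xor-identityʳ; xor-annihilates-not; not-injective; not-involutive;
         not-distribˡ-xor; ¬-not; ∧-distribˡ-xor; ∧-distribʳ-xor; ∧-zeroʳ; ∧-identityʳ; ∧-comm; ∧-assoc; ∧-idem;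
         xor-∧-commutativeRing)
  renaming (_≟_ to _≟𝔹_)
open import Data.Integer using (ℤ; -[1+_]; _⊖_; ∣_∣)
import Data.Integer as ℤ
import Data.Integer.Properties as ℤ
open import Data.Integer.DivMod using (_%ℕ_)
open import Data.Fin using (Fin; toℕ; punchIn) renaming (zero to fzero; suc to fsuc)
open import Data.Product using (_×_; _,_; proj₁; proj₂)
open import Data.Sum using (inj₁; inj₂)
open import Data.Empty using (⊥-elim)
open import Relation.Binary.PropositionalEquality using (refl; sym; trans; cong; cong₂; subst; _≢_; module ≡-Reasoning)
open import Relation.Nullary using (¬_; yes; no)
open import Relation.Binary.Definitions using (tri<; tri≈; tri>)
open import Function.Bundles using (mk⇔; module Equivalence)
open import Algebra.Bundles using (CommutativeRing)
open import Algebra.Properties.CommutativeSemigroup (CommutativeRing.+-commutativeSemigroup xor-∧-commutativeRing)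
  using (interchange)
open ≡-Reasoning

-- Arithmetic in F₂ = (Bool, xor, ∧).

xor-cancelˡ : ∀ a {b c} → a xor b ≡ a xor c → b ≡ c
xor-cancelˡ false e = e
xor-cancelˡ true  e = not-injective e

xor≡false⇒≡ : ∀ {a b} → a xor b ≡ false → a ≡ b
xor≡false⇒≡ {a} e = sym (xor-cancelˡ a (trans e (sym (xor-same a))))

xor-move : ∀ {a b c} → a xor b ≡ c → a ≡ c xor b
xor-move {a} {b} refl = sym (begin
  (a xor b) xor b ≡⟨ xor-assoc a b b ⟩
  a xor (b xor b) ≡⟨ cong (a xor_) (xor-same b) ⟩
  a xor false     ≡⟨ xor-identityʳ a ⟩
  a               ∎)

xor-sandwich : ∀ a s → (a xor s) xor a ≡ s
xor-sandwich false false = refl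
xor-sandwich false true  = refl
xor-sandwich true  false = refl
xor-sandwich true  true  = refl

∑ : ℕ → (ℕ → Bool) → Bool
∑ zero    f = false
∑ (suc n) f = ∑ n f xor f n

syntax ∑ n (λ i → e) = ∑[ i < n ] e

∑-cong : ∀ n {f g : ℕ → Bool} → (∀ i → i < n → f i ≡ g i) → ∑ n f ≡ ∑ n g
∑-cong zero    eq = refl
∑-cong (suc n) eq = cong₂ _xor_ (∑-cong n (λ i i<n → eq i (m<n⇒m<1+n i<n))) (eq n ≤-refl)

∑-ext : ∀ n {f g : ℕ → Bool} → (∀ i → f i ≡ g i) → ∑ n f ≡ ∑ n g
∑-ext n eq = ∑-cong n (λ i _ → eq i)

∑-zero : ∀ n f → (∀ i → i < n → f i ≡ false) → ∑ n f ≡ false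
∑-zero zero    f h = refl
∑-zero (suc n) f h = cong₂ _xor_ (∑-zero n f (λ i i<n → h i (m<n⇒m<1+n i<n))) (h n ≤-refl)

∑-xor : ∀ n f g → ∑[ i < n ] (f i xor g i) ≡ ∑ n f xor ∑ n g
∑-xor zero    f g = refl
∑-xor (suc n) f g = trans (cong (_xor (f n xor g n)) (∑-xor n f g)) (interchange (∑ n f) (∑ n g) (f n) (g n))

∑-∧ˡ : ∀ n a f → ∑[ i < n ] (a ∧ f i) ≡ a ∧ ∑ n f
∑-∧ˡ zero    a f = sym (∧-zeroʳ a)
∑-∧ˡ (suc n) a f = trans (cong (_xor (a ∧ f n)) (∑-∧ˡ n a f)) (sym (∧-distribˡ-xor a (∑ n f) (f n)))

∑-∧ʳ : ∀ n a f → ∑[ i < n ] (f i ∧ a) ≡ ∑ n f ∧ a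
∑-∧ʳ zero    a f = refl
∑-∧ʳ (suc n) a f = trans (cong (_xor (f n ∧ a)) (∑-∧ʳ n a f)) (sym (∧-distribʳ-xor a (∑ n f) (f n)))

∑-shift : ∀ n f → ∑ (suc n) f ≡ f 0 xor ∑[ i < n ] f (suc i)
∑-shift zero    f = sym (xor-identityʳ (f 0))
∑-shift (suc n) f = trans (cong (_xor f (suc n)) (∑-shift n f)) (xor-assoc (f 0) _ _)

∑-split : ∀ r n f → ∑ (r + n) f ≡ ∑ r f xor ∑[ u < n ] f (r + u)
∑-split r zero    f = trans (cong (λ k → ∑ k f) (+-identityʳ r)) (sym (xor-identityʳ (∑ r f)))
∑-split r (suc n) f = begin
  ∑ (r + suc n) f                                    ≡⟨ cong (λ k → ∑ k f) (+-suc r n) ⟩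
  ∑ (r + n) f xor f (r + n)                          ≡⟨ cong (_xor f (r + n)) (∑-split r n f) ⟩
  (∑ r f xor ∑[ u < n ] f (r + u)) xor f (r + n)     ≡⟨ xor-assoc (∑ r f) _ _ ⟩
  ∑ r f xor ∑[ u < suc n ] f (r + u)                 ∎

∑-truncate : ∀ n m f → n ≤ m → (∀ i → n ≤ i → i < m → f i ≡ false) → ∑ m f ≡ ∑ n f
∑-truncate n zero    f z≤n   h = refl
∑-truncate n (suc m) f n≤1+m h with m≤n⇒m<n∨m≡n n≤1+m
... | inj₂ refl      = refl
... | inj₁ (s≤s n≤m) = trans (cong₂ _xor_ (∑-truncate n m f n≤m (λ i n≤i i<m → h i n≤i (m<n⇒m<1+n i<m))) (h m n≤m ≤-refl))
                             (xor-identityʳ (∑ n f))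

∑-pair : ∀ n k g → suc k < n → (∀ j → j < n → ¬ j ≡ k → ¬ j ≡ suc k → g j ≡ false) → g k ≡ g (suc k) → ∑ n g ≡ false
∑-pair n k g sk<n others gk≡gsk = begin
  ∑ n g                            ≡⟨ ∑-truncate (suc (suc k)) n g sk<n above ⟩
  (∑ k g xor g k) xor g (suc k)    ≡⟨ cong (λ x → (x xor g k) xor g (suc k)) (∑-zero k g below) ⟩
  g k xor g (suc k)                ≡⟨ cong (g k xor_) (sym gk≡gsk) ⟩
  g k xor g k                      ≡⟨ xor-same (g k) ⟩
  false                            ∎
  where
  above : ∀ j → suc (suc k) ≤ j → j < n → g j ≡ false
  above j 2+k≤j j<n = others j j<n (>⇒≢ (<-trans (n<1+n k) 2+k≤j)) (>⇒≢ 2+k≤j)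
  below : ∀ j → j < k → g j ≡ false
  below j j<k = others j (<-trans j<k (<-trans (n<1+n k) sk<n)) (<⇒≢ j<k) (<⇒≢ (m<n⇒m<1+n j<k))

∑-triangle : ∀ m (f : ℕ → ℕ → Bool) →
  ∑[ i < suc m ] ∑[ j < suc (m ∸ i) ] f i j ≡ ∑[ k < suc m ] ∑[ i < suc k ] f i (k ∸ i)
∑-triangle zero    f = refl
∑-triangle (suc m) f = begin
  ∑[ i < suc (suc m) ] ∑[ j < suc (suc m ∸ i) ] f i j
    ≡⟨ ∑-shift (suc m) _ ⟩
  ∑[ k < suc (suc m) ] f 0 k xor ∑[ i < suc m ] ∑[ j < suc (m ∸ i) ] f (suc i) j
    ≡⟨ cong (∑[ k < suc (suc m) ] f 0 k xor_) (∑-triangle m (λ i → f (suc i))) ⟩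
  ∑[ k < suc (suc m) ] f 0 k xor ∑[ k < suc m ] ∑[ i < suc k ] f (suc i) (k ∸ i)
    ≡⟨ cong (∑[ k < suc (suc m) ] f 0 k xor_) (sym (∑-shift (suc m) (λ k → ∑[ i < k ] f (suc i) (k ∸ suc i)))) ⟩
  ∑[ k < suc (suc m) ] f 0 k xor ∑[ k < suc (suc m) ] ∑[ i < k ] f (suc i) (k ∸ suc i)
    ≡⟨ sym (∑-xor (suc (suc m)) _ _) ⟩
  ∑[ k < suc (suc m) ] (f 0 k xor ∑[ i < k ] f (suc i) (k ∸ suc i))
    ≡⟨ ∑-ext (suc (suc m)) (λ k → sym (∑-shift k (λ i → f i (k ∸ i)))) ⟩
  ∑[ k < suc (suc m) ] ∑[ i < suc k ] f i (k ∸ i) ∎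

∑-peel : ∀ k (f : ℕ → Bool) → f 0 ≡ f (suc k) → ∑ (suc (suc k)) f ≡ ∑[ t < k ] f (suc t)
∑-peel k f f0≡fk = begin
  ∑ (suc k) f xor f (suc k)          ≡⟨ cong (_xor f (suc k)) (∑-shift k f) ⟩
  (f 0 xor inner) xor f (suc k)      ≡⟨ cong (λ x → (x xor inner) xor f (suc k)) f0≡fk ⟩
  (f (suc k) xor inner) xor f (suc k) ≡⟨ xor-sandwich (f (suc k)) inner ⟩
  inner                              ∎
  where inner = ∑[ t < k ] f (suc t)

symmetric-inner : ∀ N (f : ℕ → Bool) → (∀ t → t ≤ suc (suc N) → f t ≡ f (suc (suc N) ∸ t)) →
                  ∀ t → t ≤ N → f (suc t) ≡ f (suc (N ∸ t))
symmetric-inner N f sym-f t t≤N =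
  trans (sym-f (suc t) (s≤s (m≤n⇒m≤1+n t≤N))) (cong f (+-∸-assoc 1 t≤N))

double-suc : ∀ n → suc n + suc n ≡ suc (suc (n + n))
double-suc n = cong suc (+-suc n n)

∑-symmetric-odd : ∀ n (f : ℕ → Bool) → (∀ t → t ≤ n + n → f t ≡ f (n + n ∸ t)) → ∑ (suc (n + n)) f ≡ f n
∑-symmetric-odd zero    f sym-f = refl
∑-symmetric-odd (suc n) f sym-f = begin
  ∑ (suc (suc n + suc n)) f            ≡⟨ cong (λ L → ∑ (suc L) f) (double-suc n) ⟩
  ∑ (suc (suc (suc (n + n)))) f        ≡⟨ ∑-peel (suc (n + n)) f (trans (sym-f 0 z≤n) (cong f (double-suc n))) ⟩
  ∑[ t < suc (n + n) ] f (suc t)       ≡⟨ ∑-symmetric-odd n (λ t → f (suc t)) (symmetric-inner (n + n) f sym-f′) ⟩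
  f (suc n)                            ∎
  where
  sym-f′ : ∀ t → t ≤ suc (suc (n + n)) → f t ≡ f (suc (suc (n + n)) ∸ t)
  sym-f′ rewrite sym (double-suc n) = sym-f

∑-symmetric-even : ∀ n (f : ℕ → Bool) → (∀ t → t ≤ suc (n + n) → f t ≡ f (suc (n + n) ∸ t)) → ∑ (suc (suc (n + n))) f ≡ false
∑-symmetric-even zero    f sym-f = trans (cong (_xor f 1) (sym-f 0 z≤n)) (xor-same (f 1))
∑-symmetric-even (suc n) f sym-f = begin
  ∑ (suc (suc (suc n + suc n))) f          ≡⟨ cong (λ L → ∑ (suc (suc L)) f) (double-suc n) ⟩
  ∑ (suc (suc (suc (suc (n + n))))) f      ≡⟨ ∑-peel (suc (suc (n + n))) f (trans (sym-f 0 z≤n) (cong (λ L → f (suc L)) (double-suc n))) ⟩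
  ∑[ t < suc (suc (n + n)) ] f (suc t)     ≡⟨ ∑-symmetric-even n (λ t → f (suc t)) (symmetric-inner (suc (n + n)) f sym-f′) ⟩
  false                                    ∎
  where
  sym-f′ : ∀ t → t ≤ suc (suc (suc (n + n))) → f t ≡ f (suc (suc (suc (n + n))) ∸ t)
  sym-f′ rewrite sym (double-suc n) = sym-f

∑-evens : ∀ m (f : ℕ → Bool) → (∀ i → i < m → f (suc (i + i)) ≡ false) → ∑ (suc (m + m)) f ≡ ∑[ i < suc m ] f (i + i)
∑-evens zero    f odd0 = refl
∑-evens (suc m) f odd0 = begin
  ∑ (suc (suc m + suc m)) f                         ≡⟨ cong (λ L → ∑ (suc L) f) (double-suc m) ⟩
  (∑ (suc (m + m)) f xor f (suc (m + m))) xor f (suc (suc (m + m)))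
     ≡⟨ cong₂ (λ x y → (x xor y) xor f (suc (suc (m + m)))) (∑-evens m f (λ i i<m → odd0 i (m<n⇒m<1+n i<m))) (odd0 m ≤-refl) ⟩
  (∑[ i < suc m ] f (i + i) xor false) xor f (suc (suc (m + m)))
     ≡⟨ cong₂ _xor_ (xor-identityʳ (∑[ i < suc m ] f (i + i))) (cong f (sym (double-suc m))) ⟩
  ∑[ i < suc (suc m) ] f (i + i)                    ∎

-- Determinants over F₂ of ℕ-indexed matrices, expanded along the first row.

Mat : Set
Mat = ℕ → ℕ → Bool

-- punch j s is the s-th column index different from j (ℕ-version of Fin.punchIn).
punch : ℕ → ℕ → ℕ
punch zero    s       = suc s
punch (suc j) zero    = zero
punch (suc j) (suc s) = suc (punch j s)

minor₂ : ℕ → Mat → Mat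
minor₂ j M r s = M (suc r) (punch j s)

det₂ : ℕ → Mat → Bool
det₂ zero    M = true
det₂ (suc n) M = ∑[ j < suc n ] (M 0 j ∧ det₂ n (minor₂ j M))

punch-< : ∀ {j s} → s < j → punch j s ≡ s
punch-< {suc j} {zero}  _         = refl
punch-< {suc j} {suc s} (s≤s s<j) = cong suc (punch-< s<j)

punch-≥ : ∀ {j s} → j ≤ s → punch j s ≡ suc s
punch-≥ {zero}  {s}     _         = refl
punch-≥ {suc j} {suc s} (s≤s j≤s) = cong suc (punch-≥ j≤s)

punch-bound : ∀ j {s n} → s < n → punch j s < suc n
punch-bound zero    s<n               = s≤s s<n
punch-bound (suc j) {zero}  s<n       = s≤s z≤n
punch-bound (suc j) {suc s} (s≤s s<n) = s≤s (punch-bound j s<n)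

punch-injective : ∀ j {s t} → punch j s ≡ punch j t → s ≡ t
punch-injective zero    e = suc-injective e
punch-injective (suc j) {zero}  {zero}  e = refl
punch-injective (suc j) {suc s} {suc t} e = cong suc (punch-injective j (suc-injective e))

punch-≢ : ∀ j s → punch j s ≢ j
punch-≢ zero    s       ()
punch-≢ (suc j) (suc s) e = punch-≢ j s (suc-injective e)

unpunch : ℕ → ℕ → ℕ
unpunch zero    k       = pred k
unpunch (suc j) zero    = zero
unpunch (suc j) (suc k) = suc (unpunch j k)

punch-unpunch : ∀ j k → j ≢ k → punch j (unpunch j k) ≡ k
punch-unpunch zero    zero    j≢k = ⊥-elim (j≢k refl)
punch-unpunch zero    (suc k) j≢k = refl
punch-unpunch (suc j) zero    j≢k = refl
punch-unpunch (suc j) (suc k) j≢k = cong suc (punch-unpunch j k (λ e → j≢k (cong suc e)))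

unpunch-bound : ∀ j k {n} → j ≢ k → j < suc n → k < suc n → unpunch j k < n
unpunch-bound zero    zero    j≢k _ _ = ⊥-elim (j≢k refl)
unpunch-bound zero    (suc k) j≢k _ (s≤s k<n) = k<n
unpunch-bound (suc j) zero    {zero}  j≢k (s≤s ()) _
unpunch-bound (suc j) zero    {suc n} j≢k _ _ = s≤s z≤n
unpunch-bound (suc j) (suc k) {suc n} j≢k (s≤s j<n) (s≤s k<n) = s≤s (unpunch-bound j k (λ e → j≢k (cong suc e)) j<n k<n)

unpunch-suc : ∀ j k → j ≢ k → j ≢ suc k → unpunch j (suc k) ≡ suc (unpunch j k)
unpunch-suc zero          zero    j≢k _     = ⊥-elim (j≢k refl)
unpunch-suc zero          (suc k) _   _     = refl
unpunch-suc (suc zero)    zero    _   j≢1+k = ⊥-elim (j≢1+k refl)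
unpunch-suc (suc (suc j)) zero    _   _     = refl
unpunch-suc (suc j)       (suc k) j≢k j≢1+k = cong suc (unpunch-suc j k (λ e → j≢k (cong suc e)) (λ e → j≢1+k (cong suc e)))

det₂-cong : ∀ n {A B : Mat} → (∀ r s → r < n → s < n → A r s ≡ B r s) → det₂ n A ≡ det₂ n B
det₂-cong zero    eq = refl
det₂-cong (suc n) eq = ∑-cong (suc n) λ j j<1+n →
  cong₂ _∧_ (eq 0 j (s≤s z≤n) j<1+n) (det₂-cong n (λ r s r<n s<n → eq (suc r) (punch j s) (s≤s r<n) (punch-bound j s<n)))

det₂-ext : ∀ n {A B : Mat} → (∀ r s → A r s ≡ B r s) → det₂ n A ≡ det₂ n B
det₂-ext n eq = det₂-cong n (λ r s _ _ → eq r s)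

det₂-linear : ∀ n k (A B C : Mat) → k < n →
              (∀ r s → s ≢ k → A r s ≡ B r s) → (∀ r s → s ≢ k → A r s ≡ C r s) →
              (∀ r → A r k ≡ B r k xor C r k) → det₂ n A ≡ det₂ n B xor det₂ n C
det₂-linear (suc n) k A B C k<1+n A≡B A≡C Aₖ = trans (∑-cong (suc n) term) (∑-xor (suc n) _ _)
  where
  term : ∀ j → j < suc n → A 0 j ∧ det₂ n (minor₂ j A) ≡ (B 0 j ∧ det₂ n (minor₂ j B)) xor (C 0 j ∧ det₂ n (minor₂ j C))
  term j j<1+n with j ≟ k
  ... | yes refl = begin
    A 0 j ∧ det₂ n (minor₂ j A)                              ≡⟨ cong (_∧ det₂ n (minor₂ j A)) (Aₖ 0) ⟩
    (B 0 j xor C 0 j) ∧ det₂ n (minor₂ j A)                  ≡⟨ ∧-distribʳ-xor _ (B 0 j) (C 0 j) ⟩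
    (B 0 j ∧ det₂ n (minor₂ j A)) xor (C 0 j ∧ det₂ n (minor₂ j A))
      ≡⟨ cong₂ (λ x y → (B 0 j ∧ x) xor (C 0 j ∧ y))
               (det₂-ext n (λ r s → A≡B (suc r) (punch j s) (punch-≢ j s)))
               (det₂-ext n (λ r s → A≡C (suc r) (punch j s) (punch-≢ j s))) ⟩
    (B 0 j ∧ det₂ n (minor₂ j B)) xor (C 0 j ∧ det₂ n (minor₂ j C)) ∎
  ... | no j≢k = begin
    A 0 j ∧ det₂ n (minor₂ j A)                                       ≡⟨ cong (A 0 j ∧_) minors-linear ⟩
    A 0 j ∧ (det₂ n (minor₂ j B) xor det₂ n (minor₂ j C))             ≡⟨ ∧-distribˡ-xor (A 0 j) _ _ ⟩
    (A 0 j ∧ det₂ n (minor₂ j B)) xor (A 0 j ∧ det₂ n (minor₂ j C))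
      ≡⟨ cong₂ (λ x y → (x ∧ det₂ n (minor₂ j B)) xor (y ∧ det₂ n (minor₂ j C))) (A≡B 0 j j≢k) (A≡C 0 j j≢k) ⟩
    (B 0 j ∧ det₂ n (minor₂ j B)) xor (C 0 j ∧ det₂ n (minor₂ j C)) ∎
    where
    k′ = unpunch j k
    punch-k′ : punch j k′ ≡ k
    punch-k′ = punch-unpunch j k j≢k
    off : ∀ {s} → s ≢ k′ → punch j s ≢ k
    off s≢k′ e = s≢k′ (punch-injective j (trans e (sym punch-k′)))
    minors-linear : det₂ n (minor₂ j A) ≡ det₂ n (minor₂ j B) xor det₂ n (minor₂ j C)
    minors-linear = det₂-linear n k′ (minor₂ j A) (minor₂ j B) (minor₂ j C)
      (unpunch-bound j k j≢k j<1+n k<1+n)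
      (λ r s s≢k′ → A≡B (suc r) (punch j s) (off s≢k′))
      (λ r s s≢k′ → A≡C (suc r) (punch j s) (off s≢k′))
      (λ r → subst (λ x → A (suc r) x ≡ B (suc r) x xor C (suc r) x) (sym punch-k′) (Aₖ (suc r)))

minor-adjacent : ∀ k (M : Mat) → (∀ r → M r k ≡ M r (suc k)) → ∀ r s → minor₂ k M r s ≡ minor₂ (suc k) M r s
minor-adjacent k M eq r s with <-cmp s k
... | tri< s<k _ _    = cong (M (suc r)) (trans (punch-< s<k) (sym (punch-< (m<n⇒m<1+n s<k))))
... | tri≈ _ refl _   = trans (cong (M (suc r)) (punch-≥ ≤-refl)) (trans (sym (eq (suc r))) (cong (M (suc r)) (sym (punch-< ≤-refl))))
... | tri> _ _ k<s    = cong (M (suc r)) (trans (punch-≥ (<⇒≤ k<s)) (sym (punch-≥ k<s)))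

det₂-adjacent : ∀ n k (M : Mat) → suc k < n → (∀ r → M r k ≡ M r (suc k)) → det₂ n M ≡ false
det₂-adjacent (suc n) k M 2+k≤1+n eq =
  ∑-pair (suc n) k term 2+k≤1+n vanish (cong₂ _∧_ (eq 0) (det₂-ext n (minor-adjacent k M eq)))
  where
  term : ℕ → Bool
  term j = M 0 j ∧ det₂ n (minor₂ j M)
  -- Expanding along a column j other than k, k+1 leaves a minor with equal adjacent columns.
  vanish : ∀ j → j < suc n → j ≢ k → j ≢ suc k → term j ≡ false
  vanish j j<1+n j≢k j≢1+k = trans (cong (M 0 j ∧_) (det₂-adjacent n k′ (minor₂ j M) k′-bound columns)) (∧-zeroʳ (M 0 j))
    where
    k′ = unpunch j k
    k′-bound : suc k′ < n
    k′-bound = subst (_< n) (unpunch-suc j k j≢k j≢1+k) (unpunch-bound j (suc k) j≢1+k j<1+n 2+k≤1+n)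
    columns : ∀ r → minor₂ j M r k′ ≡ minor₂ j M r (suc k′)
    columns r = begin
      M (suc r) (punch j k′)                 ≡⟨ cong (M (suc r)) (punch-unpunch j k j≢k) ⟩
      M (suc r) k                            ≡⟨ eq (suc r) ⟩
      M (suc r) (suc k)                      ≡⟨ cong (M (suc r)) (sym (punch-unpunch j (suc k) j≢1+k)) ⟩
      M (suc r) (punch j (unpunch j (suc k))) ≡⟨ cong (λ x → M (suc r) (punch j x)) (unpunch-suc j k j≢k j≢1+k) ⟩
      M (suc r) (punch j (suc k′))           ∎

setCol : Mat → ℕ → (ℕ → Bool) → Mat
setCol M k u r s with s ≟ k
... | yes _ = u r
... | no _  = M r s

setCol-at : ∀ M k u r → setCol M k u r k ≡ u r
setCol-at M k u r with k ≟ k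
... | yes _   = refl
... | no k≢k = ⊥-elim (k≢k refl)

setCol-off : ∀ M k u r s → s ≢ k → setCol M k u r s ≡ M r s
setCol-off M k u r s s≢k with s ≟ k
... | yes s≡k = ⊥-elim (s≢k s≡k)
... | no _    = refl

by-column : ∀ k {A B : Mat} → (∀ r → A r k ≡ B r k) → ∀ r s → (s ≢ k → A r s ≡ B r s) → A r s ≡ B r s
by-column k on-k r s off-k with s ≟ k
... | yes refl = on-k r
... | no s≢k   = off-k s≢k

-- D is additive in each argument and
-- vanishes on the diagonal, hence D u v = D v u over F₂: swapping two adjacent
-- columns does not change the determinant.
module AdjacentColumns (n k : ℕ) (A : Mat) (2+k≤n : suc k < n) where

  place : (ℕ → Bool) → (ℕ → Bool) → Mat
  place x y = setCol (setCol A (suc k) y) k x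

  D : (ℕ → Bool) → (ℕ → Bool) → Bool
  D x y = det₂ n (place x y)

  1+k≢k : suc k ≢ k
  1+k≢k = >⇒≢ (n<1+n k)

  place-k : ∀ x y r → place x y r k ≡ x r
  place-k x y r = setCol-at _ k x r

  place-1+k : ∀ x y r → place x y r (suc k) ≡ y r
  place-1+k x y r = trans (setCol-off _ k x r (suc k) 1+k≢k) (setCol-at A (suc k) y r)

  place-off : ∀ x y r s → s ≢ k → s ≢ suc k → place x y r s ≡ A r s
  place-off x y r s s≢k s≢1+k = trans (setCol-off _ k x r s s≢k) (setCol-off A (suc k) y r s s≢1+k)

  additiveˡ : ∀ x x′ y → D (λ r → x r xor x′ r) y ≡ D x y xor D x′ y
  additiveˡ x x′ y = det₂-linear n k _ _ _ (<-trans (n<1+n k) 2+k≤n) (same x) (same x′)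
    (λ r → trans (place-k _ y r) (sym (cong₂ _xor_ (place-k x y r) (place-k x′ y r))))
    where
    same : ∀ z r s → s ≢ k → place (λ r → x r xor x′ r) y r s ≡ place z y r s
    same z r s s≢k = trans (setCol-off _ k _ r s s≢k) (sym (setCol-off _ k z r s s≢k))

  additiveʳ : ∀ x y y′ → D x (λ r → y r xor y′ r) ≡ D x y xor D x y′
  additiveʳ x y y′ = det₂-linear n (suc k) _ _ _ 2+k≤n (same y) (same y′)
    (λ r → trans (place-1+k x _ r) (sym (cong₂ _xor_ (place-1+k x y r) (place-1+k x y′ r))))
    where
    same : ∀ z r s → s ≢ suc k → place x (λ r → y r xor y′ r) r s ≡ place x z r s
    same z r s s≢1+k = by-column k {place x (λ r → y r xor y′ r)} {place x z} (λ r → trans (place-k x _ r) (sym (place-k x z r))) r s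
      (λ s≢k → trans (place-off x _ r s s≢k s≢1+k) (sym (place-off x z r s s≢k s≢1+k)))

  diagonal : ∀ x → D x x ≡ false
  diagonal x = det₂-adjacent n k _ 2+k≤n (λ r → trans (place-k x x r) (sym (place-1+k x x r)))

  u v : ℕ → Bool
  u r = A r k
  v r = A r (suc k)

  swapped : Mat
  swapped = place v u

  swap-invariant : det₂ n A ≡ det₂ n swapped
  swap-invariant = xor≡false⇒≡ (sym (begin
    false                                     ≡⟨ sym (diagonal w) ⟩
    D w w                                     ≡⟨ additiveˡ u v w ⟩
    D u w xor D v w                           ≡⟨ cong₂ _xor_ (additiveʳ u u v) (additiveʳ v u v) ⟩
    (D u u xor D u v) xor (D v u xor D v v)   ≡⟨ cong₂ _xor_ (cong₂ _xor_ (diagonal u) D-A) (cong (D v u xor_) (diagonal v)) ⟩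
    det₂ n A xor (D v u xor false)            ≡⟨ cong (det₂ n A xor_) (xor-identityʳ (D v u)) ⟩
    det₂ n A xor D v u                        ∎))
    where
    w : ℕ → Bool
    w r = u r xor v r
    D-A : D u v ≡ det₂ n A
    D-A = det₂-ext n λ r s → by-column k {place u v} {A} (place-k u v) r s λ s≢k →
            by-column (suc k) {place u v} {A} (place-1+k u v) r s λ s≢1+k → place-off u v r s s≢k s≢1+k

-- A matrix with two equal columns has determinant zero: swap the later column
-- leftwards until the two are adjacent.
det₂-equal-columns : ∀ n t k (M : Mat) → t < k → k < n → (∀ r → M r t ≡ M r k) → det₂ n M ≡ false
det₂-equal-columns n t (suc k) M t<1+k 2+k≤n eq with m<1+n⇒m<n∨m≡n t<1+k
... | inj₂ refl = det₂-adjacent n t M 2+k≤n eq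
... | inj₁ t<k   = trans swap-invariant (det₂-equal-columns n t k swapped t<k (<-trans (n<1+n k) 2+k≤n) equal)
  where
  open AdjacentColumns n k M 2+k≤n
  equal : ∀ r → swapped r t ≡ swapped r k
  equal r = trans (place-off v u r t (<⇒≢ t<k) (<⇒≢ (m<n⇒m<1+n t<k))) (trans (eq r) (sym (place-k v u r)))

det₂-add-column : ∀ n t k b (M N : Mat) → t < k → k < n → (∀ r s → s ≢ k → N r s ≡ M r s) →
                  (∀ r → N r k ≡ M r k xor (b ∧ M r t)) → det₂ n N ≡ det₂ n M
det₂-add-column n t k false M N t<k k<n off at-k =
  det₂-ext n (λ r s → by-column k (λ r → trans (at-k r) (xor-identityʳ (M r k))) r s (off r s))
det₂-add-column n t k true  M N t<k k<n off at-k = begin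
  det₂ n N                 ≡⟨ det₂-linear n k N M C k<n off (λ r s s≢k → trans (off r s s≢k) (sym (setCol-off M k _ r s s≢k)))
                                (λ r → trans (at-k r) (cong (M r k xor_) (sym (setCol-at M k _ r)))) ⟩
  det₂ n M xor det₂ n C    ≡⟨ cong (det₂ n M xor_) (det₂-equal-columns n t k C t<k k<n C-equal) ⟩
  det₂ n M xor false       ≡⟨ xor-identityʳ (det₂ n M) ⟩
  det₂ n M                 ∎
  where
  C : Mat
  C = setCol M k (λ r → M r t)
  C-equal : ∀ r → C r t ≡ C r k
  C-equal r = trans (setCol-off M k _ r t (<⇒≢ t<k)) (sym (setCol-at M k _ r))

det₂-add-combination : ∀ n j m (γ : ℕ → Bool) (M N : Mat) → m ≤ j → j < n → (∀ r s → s ≢ j → N r s ≡ M r s) →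
                       (∀ r → N r j ≡ M r j xor ∑[ u < m ] (γ u ∧ M r u)) → det₂ n N ≡ det₂ n M
det₂-add-combination n j zero    γ M N m≤j j<n off at-j =
  det₂-ext n (λ r s → by-column j (λ r → trans (at-j r) (xor-identityʳ (M r j))) r s (off r s))
det₂-add-combination n j (suc m) γ M N m<j j<n off at-j =
  trans (det₂-add-column n m j (γ m) N′ N m<j j<n N-off N-at-j)
        (det₂-add-combination n j m γ M N′ (<⇒≤ m<j) j<n (setCol-off M j _) (setCol-at M j _))
  where
  N′ : Mat
  N′ = setCol M j (λ r → M r j xor ∑[ u < m ] (γ u ∧ M r u))
  N-off : ∀ r s → s ≢ j → N r s ≡ N′ r s
  N-off r s s≢j = trans (off r s s≢j) (sym (setCol-off M j _ r s s≢j))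
  N-at-j : ∀ r → N r j ≡ N′ r j xor (γ m ∧ N′ r m)
  N-at-j r = begin
    N r j                                                        ≡⟨ at-j r ⟩
    M r j xor (∑[ u < m ] (γ u ∧ M r u) xor (γ m ∧ M r m))       ≡⟨ sym (xor-assoc (M r j) _ _) ⟩
    (M r j xor ∑[ u < m ] (γ u ∧ M r u)) xor (γ m ∧ M r m)
      ≡⟨ cong₂ (λ x y → x xor (γ m ∧ y)) (sym (setCol-at M j _ r)) (sym (setCol-off M j _ r m (<⇒≢ m<j))) ⟩
    N′ r j xor (γ m ∧ N′ r m)                                    ∎

-- Q m takes its columns s ≥ m from T and the
-- others from M, so Q 0 = T, Q n agrees with M on the n × n square, and passing
-- from Q m to Q (m + 1) undoes the operation on the single column m.
module UnitriangularColumnOperations (n : ℕ) (M : Mat) (β : ℕ → ℕ → Bool) where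

  T : Mat
  T r s = M r s xor ∑[ u < s ] (β s u ∧ M r u)

  Q : ℕ → Mat
  Q m r s with m ≤? s
  ... | yes _ = T r s
  ... | no _  = M r s

  Q-< : ∀ {m} r s → s < m → Q m r s ≡ M r s
  Q-< {m} r s s<m with m ≤? s
  ... | yes m≤s = ⊥-elim (<⇒≱ s<m m≤s)
  ... | no _    = refl

  Q-≥ : ∀ {m} r s → m ≤ s → Q m r s ≡ T r s
  Q-≥ {m} r s m≤s with m ≤? s
  ... | yes _   = refl
  ... | no m≰s = ⊥-elim (m≰s m≤s)

  step : ∀ m → m < n → det₂ n (Q m) ≡ det₂ n (Q (suc m))
  step m m<n = det₂-add-combination n m m (β m) (Q (suc m)) (Q m) ≤-refl m<n off at-m
    where
    off : ∀ r s → s ≢ m → Q m r s ≡ Q (suc m) r s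
    off r s s≢m with <-cmp s m
    ... | tri< s<m _ _ = trans (Q-< r s s<m) (sym (Q-< r s (m<n⇒m<1+n s<m)))
    ... | tri≈ _ s≡m _ = ⊥-elim (s≢m s≡m)
    ... | tri> _ _ m<s = trans (Q-≥ r s (<⇒≤ m<s)) (sym (Q-≥ r s m<s))
    at-m : ∀ r → Q m r m ≡ Q (suc m) r m xor ∑[ u < m ] (β m u ∧ Q (suc m) r u)
    at-m r = trans (Q-≥ r m ≤-refl)
                   (cong₂ _xor_ (sym (Q-< r m ≤-refl))
                                (∑-cong m (λ u u<m → cong (β m u ∧_) (sym (Q-< r u (m<n⇒m<1+n u<m))))))

  transformed-from : ∀ m d → d + m ≡ n → det₂ n (Q m) ≡ det₂ n M
  transformed-from m zero    refl = det₂-cong n (λ r s _ s<m → Q-< r s s<m)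
  transformed-from m (suc d) 1+d+m≡n =
    trans (step m (subst (m <_) 1+d+m≡n (s≤s (m≤n+m m d)))) (transformed-from (suc m) d (trans (+-suc d m) 1+d+m≡n))

det₂-triangular : ∀ n (M : Mat) (β : ℕ → ℕ → Bool) →
                  det₂ n (λ r s → M r s xor ∑[ u < s ] (β s u ∧ M r u)) ≡ det₂ n M
det₂-triangular n M β = trans (det₂-ext n (λ r s → sym (Q-≥ r s z≤n))) (transformed-from 0 n (+-identityʳ n))
  where open UnitriangularColumnOperations n M β

det₂-unitriangular : ∀ n (N : Mat) → (∀ r s → r < s → N r s ≡ false) → (∀ r → N r r ≡ true) → det₂ n N ≡ true
det₂-unitriangular zero    N upper diagonal = refl
det₂-unitriangular (suc n) N upper diagonal = begin
  ∑[ j < suc n ] (N 0 j ∧ det₂ n (minor₂ j N))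
    ≡⟨ ∑-shift n _ ⟩
  (N 0 0 ∧ det₂ n (minor₂ 0 N)) xor ∑[ j < n ] (N 0 (suc j) ∧ det₂ n (minor₂ (suc j) N))
    ≡⟨ cong₂ _xor_ (cong₂ _∧_ (diagonal 0) minor-det)
                   (∑-zero n _ (λ j _ → cong (_∧ det₂ n (minor₂ (suc j) N)) (upper 0 (suc j) (s≤s z≤n)))) ⟩
  true ∎
  where
  minor-det : det₂ n (minor₂ 0 N) ≡ true
  minor-det = det₂-unitriangular n (minor₂ 0 N) (λ r s r<s → upper (suc r) (suc s) (s≤s r<s)) (λ r → diagonal (suc r))

kron : ℕ → ℕ → Bool
kron zero    zero    = true
kron zero    (suc s) = false
kron (suc r) zero    = false
kron (suc r) (suc s) = kron r s

kron-diag : ∀ r → kron r r ≡ true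
kron-diag zero    = refl
kron-diag (suc r) = kron-diag r

kron-off : ∀ r s → r ≢ s → kron r s ≡ false
kron-off zero    zero    r≢s = ⊥-elim (r≢s refl)
kron-off zero    (suc s) _   = refl
kron-off (suc r) zero    _   = refl
kron-off (suc r) (suc s) r≢s = kron-off r s (λ e → r≢s (cong suc e))

det₂-unit-column : ∀ n (C : Mat) → (∀ r → C r n ≡ kron r n) → det₂ (suc n) C ≡ det₂ n C
det₂-unit-column zero    C last = cong (_∧ true) (last 0)
det₂-unit-column (suc n) C last = begin
  ∑[ j < suc n ] (C 0 j ∧ det₂ (suc n) (minor₂ j C)) xor (C 0 (suc n) ∧ det₂ (suc n) (minor₂ (suc n) C))
    ≡⟨ cong₂ _xor_ (∑-cong (suc n) (λ j j≤n → cong (C 0 j ∧_) (minors j j≤n))) (cong (_∧ det₂ (suc n) (minor₂ (suc n) C)) (last 0)) ⟩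
  ∑[ j < suc n ] (C 0 j ∧ det₂ n (minor₂ j C)) xor false
    ≡⟨ xor-identityʳ _ ⟩
  det₂ (suc n) C ∎
  where
  minors : ∀ j → j < suc n → det₂ (suc n) (minor₂ j C) ≡ det₂ n (minor₂ j C)
  minors j (s≤s j≤n) = det₂-unit-column n (minor₂ j C) (λ r → trans (cong (C (suc r)) (punch-≥ j≤n)) (last (suc r)))

-- Flipping the corner entry of an (n+1) × (n+1) matrix changes its determinant by
-- that of the leading n × n block (linearity in the last column).
det₂-flip-corner : ∀ n (A B : Mat) → (∀ r s → r < suc n → s < suc n → ¬ (r ≡ n × s ≡ n) → B r s ≡ A r s) →
                   B n n ≡ not (A n n) → det₂ (suc n) B ≡ det₂ (suc n) A xor det₂ n A
det₂-flip-corner n A B same corner = begin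
  det₂ (suc n) B              ≡⟨ det₂-cong (suc n) B≡A+E ⟩
  det₂ (suc n) A+E            ≡⟨ det₂-linear (suc n) n A+E A E ≤-refl (setCol-off A n _) (λ r s s≢n → trans (setCol-off A n _ r s s≢n) (sym (setCol-off A n _ r s s≢n)))
                                   (λ r → trans (setCol-at A n _ r) (cong (A r n xor_) (sym (setCol-at A n _ r)))) ⟩
  det₂ (suc n) A xor det₂ (suc n) E ≡⟨ cong (det₂ (suc n) A xor_) (det₂-unit-column n E (setCol-at A n _)) ⟩
  det₂ (suc n) A xor det₂ n E ≡⟨ cong (det₂ (suc n) A xor_) (det₂-cong n (λ r s _ s<n → setCol-off A n _ r s (<⇒≢ s<n))) ⟩
  det₂ (suc n) A xor det₂ n A ∎
  where
  E A+E : Mat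
  E   = setCol A n (λ r → kron r n)
  A+E = setCol A n (λ r → A r n xor kron r n)
  B≡A+E : ∀ r s → r < suc n → s < suc n → B r s ≡ A+E r s
  B≡A+E r s r≤n s≤n with m<1+n⇒m<n∨m≡n s≤n | m<1+n⇒m<n∨m≡n r≤n
  ... | inj₁ s<n  | _         = trans (same r s r≤n s≤n (λ p → <⇒≢ s<n (proj₂ p))) (sym (setCol-off A n _ r s (<⇒≢ s<n)))
  ... | inj₂ refl | inj₂ refl = trans corner (sym (trans (setCol-at A s _ s) (trans (cong (A s s xor_) (kron-diag s)) (xor-comm (A s s) true))))
  ... | inj₂ refl | inj₁ r<n  = trans (same r s r≤n s≤n (λ p → <⇒≢ r<n (proj₁ p)))
                                      (sym (trans (setCol-at A s _ r) (trans (cong (A r s xor_) (kron-off r s (<⇒≢ r<n))) (xor-identityʳ (A r s)))))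

-- Formal power series over F₂.

Series : Set
Series = ℕ → Bool

_⋆_ : Series → Series → Series
(F ⋆ G) m = ∑[ t < suc m ] (F t ∧ G (m ∸ t))

infixl 7 _⋆_

𝟙 : Series
𝟙 m = kron m 0

⋆-cong : ∀ {F F′ G G′ : Series} → (∀ i → F i ≡ F′ i) → (∀ i → G i ≡ G′ i) → ∀ m → (F ⋆ G) m ≡ (F′ ⋆ G′) m
⋆-cong F≡F′ G≡G′ m = ∑-ext (suc m) (λ t → cong₂ _∧_ (F≡F′ t) (G≡G′ (m ∸ t)))

⋆-identityˡ : ∀ G m → (𝟙 ⋆ G) m ≡ G m
⋆-identityˡ G m = trans (∑-shift m _) (trans (cong (G m xor_) (∑-zero m _ (λ _ _ → refl))) (xor-identityʳ (G m)))

⋆-identityʳ : ∀ F m → (F ⋆ 𝟙) m ≡ F m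
⋆-identityʳ F m = begin
  ∑[ t < m ] (F t ∧ 𝟙 (m ∸ t)) xor (F m ∧ 𝟙 (m ∸ m)) ≡⟨ cong₂ _xor_ (∑-zero m _ early) (cong (λ x → F m ∧ 𝟙 x) (n∸n≡0 m)) ⟩
  false xor (F m ∧ true)                              ≡⟨ ∧-identityʳ (F m) ⟩
  F m                                                 ∎
  where
  early : ∀ t → t < m → F t ∧ 𝟙 (m ∸ t) ≡ false
  early t t<m = trans (cong (F t ∧_) (kron-off (m ∸ t) 0 (m>n⇒m∸n≢0 t<m))) (∧-zeroʳ (F t))

⋆-distribʳ : ∀ F F′ G m → ((λ i → F i xor F′ i) ⋆ G) m ≡ (F ⋆ G) m xor (F′ ⋆ G) m
⋆-distribʳ F F′ G m = trans (∑-ext (suc m) (λ t → ∧-distribʳ-xor (G (m ∸ t)) (F t) (F′ t))) (∑-xor (suc m) _ _)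

⋆-distribˡ : ∀ F G G′ m → (F ⋆ (λ i → G i xor G′ i)) m ≡ (F ⋆ G) m xor (F ⋆ G′) m
⋆-distribˡ F G G′ m = trans (∑-ext (suc m) (λ t → ∧-distribˡ-xor (F t) (G (m ∸ t)) (G′ (m ∸ t)))) (∑-xor (suc m) _ _)

-- Associativity, via reindexing the triangle i + j ≤ m by k = i + j.
⋆-assoc : ∀ F G H m → (F ⋆ (G ⋆ H)) m ≡ ((F ⋆ G) ⋆ H) m
⋆-assoc F G H m = begin
  ∑[ i < suc m ] (F i ∧ ∑[ j < suc (m ∸ i) ] (G j ∧ H (m ∸ i ∸ j)))
    ≡⟨ ∑-ext (suc m) (λ i → sym (∑-∧ˡ (suc (m ∸ i)) (F i) _)) ⟩
  ∑[ i < suc m ] ∑[ j < suc (m ∸ i) ] (F i ∧ (G j ∧ H (m ∸ i ∸ j)))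
    ≡⟨ ∑-triangle m (λ i j → F i ∧ (G j ∧ H (m ∸ i ∸ j))) ⟩
  ∑[ k < suc m ] ∑[ i < suc k ] (F i ∧ (G (k ∸ i) ∧ H (m ∸ i ∸ (k ∸ i))))
    ≡⟨ ∑-cong (suc m) (λ k k<1+m → ∑-cong (suc k) (λ i i<1+k → reassociate k i (≤-pred k<1+m) (≤-pred i<1+k))) ⟩
  ∑[ k < suc m ] ∑[ i < suc k ] ((F i ∧ G (k ∸ i)) ∧ H (m ∸ k))
    ≡⟨ ∑-ext (suc m) (λ k → ∑-∧ʳ (suc k) (H (m ∸ k)) _) ⟩
  ∑[ k < suc m ] ((F ⋆ G) k ∧ H (m ∸ k)) ∎
  where
  reassociate : ∀ k i → k ≤ m → i ≤ k → F i ∧ (G (k ∸ i) ∧ H (m ∸ i ∸ (k ∸ i))) ≡ (F i ∧ G (k ∸ i)) ∧ H (m ∸ k)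
  reassociate k i k≤m i≤k = trans (sym (∧-assoc (F i) _ _))
    (cong (λ x → (F i ∧ G (k ∸ i)) ∧ H x) (trans (∸-+-assoc m i (k ∸ i)) (cong (m ∸_) (m+[n∸m]≡n i≤k))))

square-term-symmetric : ∀ (h : Series) N t → t ≤ N → h t ∧ h (N ∸ t) ≡ h (N ∸ t) ∧ h (N ∸ (N ∸ t))
square-term-symmetric h N t t≤N = trans (∧-comm (h t) _) (cong (λ x → h (N ∸ t) ∧ h x) (sym (m∸[m∸n]≡n t≤N)))

⋆-square-even : ∀ (h : Series) n → (h ⋆ h) (n + n) ≡ h n
⋆-square-even h n = begin
  (h ⋆ h) (n + n)      ≡⟨ ∑-symmetric-odd n _ (square-term-symmetric h (n + n)) ⟩
  h n ∧ h (n + n ∸ n)  ≡⟨ cong (λ x → h n ∧ h x) (m+n∸n≡m n n) ⟩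
  h n ∧ h n            ≡⟨ ∧-idem (h n) ⟩
  h n                  ∎

⋆-square-odd : ∀ (h : Series) n → (h ⋆ h) (suc (n + n)) ≡ false
⋆-square-odd h n = ∑-symmetric-even n _ (square-term-symmetric h (suc (n + n)))

double-∸ : ∀ m i → i ≤ m → m + m ∸ (i + i) ≡ (m ∸ i) + (m ∸ i)
double-∸ m       zero    _         = refl
double-∸ (suc m) (suc i) (s≤s i≤m) = trans (cong₂ _∸_ (double-suc m) (double-suc i)) (double-∸ m i i≤m)

double-∸-odd : ∀ m i → i < m → m + m ∸ suc (i + i) ≡ suc ((m ∸ suc i) + (m ∸ suc i))
double-∸-odd (suc m) zero    _         = cong (_∸ 1) (double-suc m)
double-∸-odd (suc m) (suc i) (s≤s i<m) = trans (cong₂ _∸_ (double-suc m) (cong suc (double-suc i))) (double-∸-odd m i i<m)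

evens : Series → Series
evens Q i = Q (i + i)

⋆-square-evens : ∀ Q h m → (Q ⋆ (h ⋆ h)) (m + m) ≡ (evens Q ⋆ h) m
⋆-square-evens Q h m = begin
  (Q ⋆ (h ⋆ h)) (m + m)                                      ≡⟨ ∑-evens m _ odd-terms ⟩
  ∑[ i < suc m ] (Q (i + i) ∧ (h ⋆ h) (m + m ∸ (i + i)))     ≡⟨ ∑-cong (suc m) (λ i i≤m → cong (Q (i + i) ∧_) (even-term i (≤-pred i≤m))) ⟩
  (evens Q ⋆ h) m                                            ∎
  where
  odd-terms : ∀ i → i < m → Q (suc (i + i)) ∧ (h ⋆ h) (m + m ∸ suc (i + i)) ≡ false
  odd-terms i i<m = trans (cong (λ x → Q (suc (i + i)) ∧ (h ⋆ h) x) (double-∸-odd m i i<m))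
                          (trans (cong (Q (suc (i + i)) ∧_) (⋆-square-odd h (m ∸ suc i))) (∧-zeroʳ _))
  even-term : ∀ i → i ≤ m → (h ⋆ h) (m + m ∸ (i + i)) ≡ h (m ∸ i)
  even-term i i≤m = trans (cong (h ⋆ h) (double-∸ m i i≤m)) (⋆-square-even h (m ∸ i))

x· : Series → Series
x· F zero    = false
x· F (suc i) = F i

⋆-x·ˡ : ∀ F G m → (x· F ⋆ G) (suc m) ≡ (F ⋆ G) m
⋆-x·ˡ F G m = ∑-shift (suc m) _

1+x : Series
1+x zero          = true
1+x (suc zero)    = true
1+x (suc (suc _)) = false

⋆-1+x : ∀ G k → (1+x ⋆ G) (suc k) ≡ G (suc k) xor G k
⋆-1+x G k = begin
  (1+x ⋆ G) (suc k)                                ≡⟨ ∑-shift (suc k) _ ⟩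
  G (suc k) xor ∑[ t < suc k ] (1+x (suc t) ∧ G (k ∸ t)) ≡⟨ cong (G (suc k) xor_) (∑-shift k _) ⟩
  G (suc k) xor (G k xor ∑[ t < k ] false)         ≡⟨ cong (λ x → G (suc k) xor (G k xor x)) (∑-zero k _ (λ _ _ → refl)) ⟩
  G (suc k) xor (G k xor false)                    ≡⟨ cong (G (suc k) xor_) (xor-identityʳ (G k)) ⟩
  G (suc k) xor G k                                ∎

-- Course-of-values recursion for sequences: if Φ g m only inspects g below m,
-- then g = Φ g has the solution fix Φ, computed by iterating Φ sufficiently often.
Guarded : (Series → Series) → Set
Guarded Φ = ∀ g g′ m → (∀ i → i < m → g i ≡ g′ i) → Φ g m ≡ Φ g′ m

-- iterate Φ k approximates the solution: it is correct below k.
iterate : (Series → Series) → ℕ → Series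
iterate Φ zero    = λ _ → false
iterate Φ (suc k) = Φ (iterate Φ k)

fix : (Series → Series) → Series
fix Φ m = iterate Φ (suc m) m

module _ {Φ : Series → Series} (guarded : Guarded Φ) where

  iterate-stable : ∀ k k′ m → m < k → m < k′ → iterate Φ k m ≡ iterate Φ k′ m
  iterate-stable (suc k) (suc k′) m (s≤s m≤k) (s≤s m≤k′) =
    guarded _ _ m (λ i i<m → iterate-stable k k′ i (<-≤-trans i<m m≤k) (<-≤-trans i<m m≤k′))

  fix-unfold : ∀ m → fix Φ m ≡ Φ (fix Φ) m
  fix-unfold m = guarded _ _ m (λ i i<m → iterate-stable m (suc i) i i<m ≤-refl)

inverse-step : Series → Series → Series
inverse-step F g zero    = true
inverse-step F g (suc m) = ∑[ t < suc m ] (F (suc t) ∧ g (m ∸ t))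

inverse : Series → Series
inverse F = fix (inverse-step F)

inverse-unfold : ∀ F m → inverse F (suc m) ≡ ∑[ t < suc m ] (F (suc t) ∧ inverse F (m ∸ t))
inverse-unfold F m = fix-unfold guarded (suc m)
  where
  guarded : Guarded (inverse-step F)
  guarded g g′ zero    eq = refl
  guarded g g′ (suc m) eq = ∑-ext (suc m) (λ t → cong (F (suc t) ∧_) (eq (m ∸ t) (s≤s (m∸n≤m m t))))

⋆-inverse : ∀ F → F 0 ≡ true → ∀ m → (F ⋆ inverse F) m ≡ 𝟙 m
⋆-inverse F F₀ zero    = cong (_∧ true) F₀
⋆-inverse F F₀ (suc m) = begin
  (F ⋆ inverse F) (suc m)                                            ≡⟨ ∑-shift (suc m) _ ⟩
  (F 0 ∧ inverse F (suc m)) xor S                                    ≡⟨ cong (λ x → (x ∧ inverse F (suc m)) xor S) F₀ ⟩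
  inverse F (suc m) xor S                                            ≡⟨ cong (_xor S) (inverse-unfold F m) ⟩
  S xor S                                                            ≡⟨ xor-same S ⟩
  false                                                              ∎
  where S = ∑[ t < suc m ] (F (suc t) ∧ inverse F (m ∸ t))

Recurrent : Series → Set
Recurrent c = ∀ n → c (suc (n + n)) xor c (suc (suc (n + n))) ≡ c n

evens-1+x⋆ : ∀ F → F 0 ≡ true → Recurrent F → ∀ i → evens (1+x ⋆ F) i ≡ 𝟙 i xor x· F i
evens-1+x⋆ F F₀ rec zero    = F₀
evens-1+x⋆ F F₀ rec (suc i) = begin
  (1+x ⋆ F) (suc i + suc i)                  ≡⟨ cong (1+x ⋆ F) (double-suc i) ⟩
  (1+x ⋆ F) (suc (suc (i + i)))              ≡⟨ ⋆-1+x F (suc (i + i)) ⟩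
  F (suc (suc (i + i))) xor F (suc (i + i))  ≡⟨ xor-comm _ (F (suc (i + i))) ⟩
  F (suc (i + i)) xor F (suc (suc (i + i)))  ≡⟨ rec i ⟩
  F i                                        ∎

module InverseOfRecurrent (F : Series) (F₀ : F 0 ≡ true) (rec : Recurrent F) where

  h : Series
  h = inverse F

  1+x⋆F⋆h : ∀ i → ((1+x ⋆ F) ⋆ h) i ≡ 1+x i
  1+x⋆F⋆h i = trans (sym (⋆-assoc 1+x F h i)) (trans (⋆-cong (λ _ → refl) (⋆-inverse F F₀) i) (⋆-identityʳ 1+x i))

  -- The key identity h_{2j+1} + h_{2j+2} = h_{j+1} + [j = 0]: write (1 + x) h as
  -- (1 + x) F · h², and use that (1 + x) F has even part 1 + x F.
  inverse-identity : ∀ j → h (suc (j + j)) xor h (suc (suc (j + j))) ≡ h (suc j) xor 𝟙 j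
  inverse-identity j = begin
    h (suc (j + j)) xor h (suc (suc (j + j)))  ≡⟨ xor-comm (h (suc (j + j))) _ ⟩
    h (suc (suc (j + j))) xor h (suc (j + j))  ≡⟨ sym (⋆-1+x h (suc (j + j))) ⟩
    (1+x ⋆ h) (suc (suc (j + j)))              ≡⟨ cong (1+x ⋆ h) (sym (double-suc j)) ⟩
    (1+x ⋆ h) (m + m)                          ≡⟨ ⋆-cong {G = h} {G′ = h} (λ i → sym (1+x⋆F⋆h i)) (λ _ → refl) (m + m) ⟩
    (((1+x ⋆ F) ⋆ h) ⋆ h) (m + m)              ≡⟨ sym (⋆-assoc (1+x ⋆ F) h h (m + m)) ⟩
    ((1+x ⋆ F) ⋆ (h ⋆ h)) (m + m)              ≡⟨ ⋆-square-evens (1+x ⋆ F) h m ⟩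
    (evens (1+x ⋆ F) ⋆ h) m                    ≡⟨ ⋆-cong {G = h} {G′ = h} (evens-1+x⋆ F F₀ rec) (λ _ → refl) m ⟩
    ((λ i → 𝟙 i xor x· F i) ⋆ h) m             ≡⟨ ⋆-distribʳ 𝟙 (x· F) h m ⟩
    (𝟙 ⋆ h) m xor (x· F ⋆ h) m                 ≡⟨ cong₂ _xor_ (⋆-identityˡ h m) (⋆-x·ˡ F h j) ⟩
    h m xor (F ⋆ h) j                          ≡⟨ cong (h m xor_) (⋆-inverse F F₀ j) ⟩
    h (suc j) xor 𝟙 j                          ∎
    where m = suc j

  tail : Series
  tail j = h (suc (suc j))

  tail-0 : tail 0 ≡ true
  tail-0 = xor-cancelˡ (h 1) (inverse-identity 0)

  tail-recurrent : Recurrent tail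
  tail-recurrent n = begin
    tail (suc (n + n)) xor tail (suc (suc (n + n)))              ≡⟨ cong₂ (λ a b → h (suc a) xor h (suc (suc a))) (sym (double-suc n)) (sym (double-suc n)) ⟩
    h (suc (suc n + suc n)) xor h (suc (suc (suc n + suc n)))    ≡⟨ inverse-identity (suc n) ⟩
    h (suc (suc n)) xor false                                    ≡⟨ xor-identityʳ _ ⟩
    tail n                                                       ∎

⋆-vanishing : ∀ F T j → (∀ i → i < j → T i ≡ false) → ∀ m → m < j → (F ⋆ T) m ≡ false
⋆-vanishing F T j T-low m m<j =
  ∑-zero (suc m) _ (λ t _ → trans (cong (F t ∧_) (T-low (m ∸ t) (≤-<-trans (m∸n≤m m t) m<j))) (∧-zeroʳ (F t)))

⋆-order : ∀ F T j → (∀ i → i < j → T i ≡ false) → (F ⋆ T) j ≡ F 0 ∧ T j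
⋆-order F T j T-low = begin
  (F ⋆ T) j                                          ≡⟨ ∑-shift j _ ⟩
  (F 0 ∧ T j) xor ∑[ t < j ] (F (suc t) ∧ T (j ∸ suc t)) ≡⟨ cong ((F 0 ∧ T j) xor_) (∑-zero j _ later) ⟩
  (F 0 ∧ T j) xor false                              ≡⟨ xor-identityʳ _ ⟩
  F 0 ∧ T j                                          ∎
  where
  later : ∀ t → t < j → F (suc t) ∧ T (j ∸ suc t) ≡ false
  later t t<j = trans (cong (F (suc t) ∧_) (T-low (j ∸ suc t) (∸-monoʳ-< (s≤s z≤n) t<j))) (∧-zeroʳ (F (suc t)))

-- A Padé-type denominator of order k for F: a polynomial A of degree ≤ k with
-- A 0 = 1 such that F A has coefficients 0 at k, …, 2k - 1 and 1 at 2k.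
record Denominator (F : Series) (k : ℕ) : Set where
  field
    poly     : Series
    constant : poly 0 ≡ true
    degree   : ∀ t → k < t → poly t ≡ false
    gap      : ∀ m → k ≤ m → m < k + k → (F ⋆ poly) m ≡ false
    leading  : (F ⋆ poly) (k + k) ≡ true

-- If R is a denominator of order k for the tail of h = F⁻¹, then the truncation A
-- of W = h R to degree k + 1 is a denominator of order k + 1 for F: F A = R + F T
-- with T = W - A, and T starts only at index 2k + 2, with coefficient 1 there.
module DenominatorStep (F : Series) (F₀ : F 0 ≡ true) (rec : Recurrent F) (k : ℕ)
                       (R : Denominator (InverseOfRecurrent.tail F F₀ rec) k) where
  open InverseOfRecurrent F F₀ rec
  private module R = Denominator R

  W : Series
  W = h ⋆ R.poly

  W-late : ∀ t → k ≤ t → W (suc (suc t)) ≡ (tail ⋆ R.poly) t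
  W-late t k≤t = begin
    W (suc (suc t))                                                        ≡⟨ ∑-shift (suc (suc t)) _ ⟩
    R.poly (suc (suc t)) xor ∑[ s < suc (suc t) ] (h (suc s) ∧ R.poly (suc t ∸ s)) ≡⟨ cong (R.poly (suc (suc t)) xor_) (∑-shift (suc t) _) ⟩
    R.poly (suc (suc t)) xor ((h 1 ∧ R.poly (suc t)) xor (tail ⋆ R.poly) t)
      ≡⟨ cong₂ (λ a b → a xor ((h 1 ∧ b) xor (tail ⋆ R.poly) t)) (R.degree _ (s≤s (m≤n⇒m≤1+n k≤t))) (R.degree _ (s≤s k≤t)) ⟩
    (h 1 ∧ false) xor (tail ⋆ R.poly) t                                    ≡⟨ cong (_xor (tail ⋆ R.poly) t) (∧-zeroʳ (h 1)) ⟩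
    (tail ⋆ R.poly) t                                                      ∎

  A T : Series
  A t with t ≤? suc k
  ... | yes _ = W t
  ... | no _  = false
  T t with t ≤? suc k
  ... | yes _ = false
  ... | no _  = W t

  W≡A+T : ∀ t → W t ≡ A t xor T t
  W≡A+T t with t ≤? suc k
  ... | yes _ = sym (xor-identityʳ (W t))
  ... | no _  = refl

  A-degree : ∀ t → suc k < t → A t ≡ false
  A-degree t 1+k<t with t ≤? suc k
  ... | yes t≤1+k = ⊥-elim (<⇒≱ 1+k<t t≤1+k)
  ... | no _      = refl

  T-low : ∀ i → i < suc k + suc k → T i ≡ false
  T-low i i<2k+2 with i ≤? suc k
  ... | yes _     = refl
  ... | no i≰1+k = middle i (≰⇒> i≰1+k) i<2k+2
    where
    middle : ∀ i → suc k < i → i < suc k + suc k → W i ≡ false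
    middle (suc (suc t)) (s≤s (s≤s k≤t)) i<2k+2 =
      trans (W-late t k≤t) (R.gap t k≤t (≤-pred (≤-pred (subst (suc (suc (suc t)) ≤_) (double-suc k) i<2k+2))))

  T-leading : T (suc k + suc k) ≡ true
  T-leading with suc k + suc k ≤? suc k
  ... | yes 2k+2≤1+k = ⊥-elim (<⇒≱ (s≤s (m≤n+m (suc k) k)) 2k+2≤1+k)
  ... | no _         = trans (cong W (double-suc k)) (trans (W-late (k + k) (m≤m+n k k)) R.leading)

  -- F A = R + F T, since F W = (F h) R = R.
  F⋆A : ∀ m → (F ⋆ A) m ≡ R.poly m xor (F ⋆ T) m
  F⋆A m = xor-move (begin
    (F ⋆ A) m xor (F ⋆ T) m  ≡⟨ sym (⋆-distribˡ F A T m) ⟩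
    (F ⋆ (λ t → A t xor T t)) m ≡⟨ ⋆-cong (λ _ → refl) (λ t → sym (W≡A+T t)) m ⟩
    (F ⋆ (h ⋆ R.poly)) m     ≡⟨ ⋆-assoc F h R.poly m ⟩
    ((F ⋆ h) ⋆ R.poly) m     ≡⟨ ⋆-cong {G = R.poly} {G′ = R.poly} (⋆-inverse F F₀) (λ _ → refl) m ⟩
    (𝟙 ⋆ R.poly) m           ≡⟨ ⋆-identityˡ R.poly m ⟩
    R.poly m                 ∎)

  A-gap : ∀ m → suc k ≤ m → m < suc k + suc k → (F ⋆ A) m ≡ false
  A-gap m 1+k≤m m<2k+2 = trans (F⋆A m) (cong₂ _xor_ (R.degree m 1+k≤m) (⋆-vanishing F T _ T-low m m<2k+2))

  A-leading : (F ⋆ A) (suc k + suc k) ≡ true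
  A-leading = trans (F⋆A _) (cong₂ _xor_ (R.degree _ (s≤s (m≤m+n k (suc k))))
                                         (trans (⋆-order F T _ T-low) (cong₂ _∧_ F₀ T-leading)))

  lifted : Denominator F (suc k)
  lifted = record { poly = A ; constant = R.constant ; degree = A-degree ; gap = A-gap ; leading = A-leading }

denominator : ∀ k F → F 0 ≡ true → Recurrent F → Denominator F k
denominator zero    F F₀ rec = record
  { poly = 𝟙 ; constant = refl ; degree = λ { (suc t) _ → refl } ; gap = λ _ _ () ; leading = trans (⋆-identityʳ F 0) F₀ }
denominator (suc k) F F₀ rec = DenominatorStep.lifted F F₀ rec k (denominator k tail tail-0 tail-recurrent)
  where open InverseOfRecurrent F F₀ rec

hankel : Series → Mat
hankel a r s = a (r + s)

⋆-polynomial : ∀ c A r s → A 0 ≡ true → (∀ t → s < t → A t ≡ false) →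
               (c ⋆ A) (r + s) ≡ c (r + s) xor ∑[ u < s ] (A (s ∸ u) ∧ c (r + u))
⋆-polynomial c A r s A₀ degree = begin
  ∑[ t < suc (r + s) ] (c t ∧ A (r + s ∸ t))
    ≡⟨ cong (λ k → ∑[ t < k ] (c t ∧ A (r + s ∸ t))) (sym (+-suc r s)) ⟩
  ∑[ t < r + suc s ] (c t ∧ A (r + s ∸ t))
    ≡⟨ ∑-split r (suc s) _ ⟩
  ∑[ t < r ] (c t ∧ A (r + s ∸ t)) xor ∑[ u < suc s ] (c (r + u) ∧ A (r + s ∸ (r + u)))
    ≡⟨ cong₂ _xor_ (∑-zero r _ low) (∑-ext (suc s) (λ u → cong (λ x → c (r + u) ∧ A x) ([m+n]∸[m+o]≡n∸o r s u))) ⟩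
  ∑[ u < s ] (c (r + u) ∧ A (s ∸ u)) xor (c (r + s) ∧ A (s ∸ s))
    ≡⟨ cong₂ _xor_ (∑-ext s (λ u → ∧-comm (c (r + u)) _)) (trans (cong (λ x → c (r + s) ∧ A x) (n∸n≡0 s)) (trans (cong (c (r + s) ∧_) A₀) (∧-identityʳ _))) ⟩
  ∑[ u < s ] (A (s ∸ u) ∧ c (r + u)) xor c (r + s)
    ≡⟨ xor-comm _ (c (r + s)) ⟩
  c (r + s) xor ∑[ u < s ] (A (s ∸ u) ∧ c (r + u)) ∎
  where
  low : ∀ t → t < r → c t ∧ A (r + s ∸ t) ≡ false
  low t t<r = trans (cong (c t ∧_) (degree _ s<r+s∸t)) (∧-zeroʳ (c t))
    where
    s<r+s∸t : s < r + s ∸ t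
    s<r+s∸t = subst (s <_) (sym (+-∸-comm s (<⇒≤ t<r))) (+-monoˡ-< s (m<n⇒0<n∸m t<r))

-- Sufficiency: if c 0 = 1 and c satisfies the recurrence, every Hankel determinant
-- of c is 1.  Subtracting from column s of the Hankel matrix the combination of
-- earlier columns given by the denominator A_s of order s turns it into the lower
-- unitriangular matrix ((c A_s)_{r + s})_{r , s}.
recurrent⇒hankel : ∀ c → c 0 ≡ true → Recurrent c → ∀ n → det₂ n (hankel c) ≡ true
recurrent⇒hankel c c₀ rec n = begin
  det₂ n (hankel c)                                                   ≡⟨ sym (det₂-triangular n (hankel c) β) ⟩
  det₂ n (λ r s → c (r + s) xor ∑[ u < s ] (β s u ∧ c (r + u)))
    ≡⟨ det₂-ext n (λ r s → sym (⋆-polynomial c (A s) r s (Denominator.constant (D s)) (Denominator.degree (D s)))) ⟩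
  det₂ n N                                                            ≡⟨ det₂-unitriangular n N upper diagonal ⟩
  true                                                                ∎
  where
  D : ∀ s → Denominator c s
  D s = denominator s c c₀ rec
  A : ℕ → Series
  A s = Denominator.poly (D s)
  β : ℕ → ℕ → Bool
  β s u = A s (s ∸ u)
  N : Mat
  N r s = (c ⋆ A s) (r + s)
  upper : ∀ r s → r < s → N r s ≡ false
  upper r s r<s = Denominator.gap (D s) (r + s) (m≤n+m s r) (+-monoˡ-< s r<s)
  diagonal : ∀ r → N r r ≡ true
  diagonal r = Denominator.leading (D r)

hankel-flip : ∀ n a a′ → (∀ m → m < n + n → a′ m ≡ a m) → a′ (n + n) ≡ not (a (n + n)) →
              det₂ (suc n) (hankel a′) ≡ det₂ (suc n) (hankel a) xor det₂ n (hankel a)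
hankel-flip n a a′ below corner = det₂-flip-corner n (hankel a) (hankel a′) same corner
  where
  same : ∀ r s → r < suc n → s < suc n → ¬ (r ≡ n × s ≡ n) → a′ (r + s) ≡ a (r + s)
  same r s (s≤s r≤n) (s≤s s≤n) not-corner with r ≟ n
  ... | yes refl = below (r + s) (+-monoʳ-< r (≤∧≢⇒< s≤n (λ s≡n → not-corner (refl , s≡n))))
  ... | no r≢n   = below (r + s) (+-mono-<-≤ (≤∧≢⇒< r≤n r≢n) s≤n)

even : ℕ → Bool
even zero    = true
even (suc m) = not (even m)

even-double : ∀ i → even (i + i) ≡ true
even-double zero    = refl
even-double (suc i) = trans (cong (λ k → not (even k)) (+-suc i i)) (trans (not-involutive (even (i + i))) (even-double i))

half-odd : ∀ i → ⌊ suc (i + i) /2⌋ ≡ i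
half-odd zero    = refl
half-odd (suc i) = trans (cong (λ k → ⌊ suc (suc k) /2⌋) (+-suc i i)) (cong suc (half-odd i))

-- The recurrent completion of c: it keeps the coefficients of c at 0 and at odd
-- indices, and defines those at even indices 2i + 2 by the recurrence.
completion-step : Series → Series → Series
completion-step c g zero    = true
completion-step c g (suc m) = if even m then c (suc m) else (g ⌊ m /2⌋ xor c m)

completion : Series → Series
completion c = fix (completion-step c)

-- The completion is well defined: each step looks only at ⌊ m / 2 ⌋ < m + 1.
completion-guarded : ∀ c → Guarded (completion-step c)
completion-guarded c g g′ zero    eq = refl
completion-guarded c g g′ (suc m) eq = cong (λ x → if even m then c (suc m) else (x xor c m)) (eq ⌊ m /2⌋ (s≤s (⌊n/2⌋≤n m)))

completion-unfold : ∀ c m → completion c m ≡ completion-step c (completion c) m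
completion-unfold c = fix-unfold (completion-guarded c)

completion-odd : ∀ c i → completion c (suc (i + i)) ≡ c (suc (i + i))
completion-odd c i = trans (completion-unfold c (suc (i + i)))
  (cong (λ b → if b then c (suc (i + i)) else (completion c ⌊ i + i /2⌋ xor c (i + i))) (even-double i))

completion-even : ∀ c i → completion c (suc (suc (i + i))) ≡ completion c i xor c (suc (i + i))
completion-even c i = begin
  completion c (suc (suc (i + i)))                                  ≡⟨ completion-unfold c (suc (suc (i + i))) ⟩
  (if not (even (i + i)) then c (suc (suc (i + i))) else (completion c ⌊ suc (i + i) /2⌋ xor c (suc (i + i))))
    ≡⟨ cong (λ b → if not b then c (suc (suc (i + i))) else (completion c ⌊ suc (i + i) /2⌋ xor c (suc (i + i)))) (even-double i) ⟩
  completion c ⌊ suc (i + i) /2⌋ xor c (suc (i + i))                ≡⟨ cong (λ k → completion c k xor c (suc (i + i))) (half-odd i) ⟩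
  completion c i xor c (suc (i + i))                                ∎

completion-recurrent : ∀ c → Recurrent (completion c)
completion-recurrent c n = begin
  completion c (suc (n + n)) xor completion c (suc (suc (n + n)))   ≡⟨ cong₂ _xor_ (completion-odd c n) (completion-even c n) ⟩
  c (suc (n + n)) xor (completion c n xor c (suc (n + n)))          ≡⟨ sym (xor-assoc (c (suc (n + n))) _ _) ⟩
  (c (suc (n + n)) xor completion c n) xor c (suc (n + n))          ≡⟨ xor-sandwich (c (suc (n + n))) (completion c n) ⟩
  completion c n                                                    ∎

data Shape : ℕ → Set where
  origin   : Shape 0
  odd      : ∀ i → Shape (suc (i + i))
  positive : ∀ i → Shape (suc (suc (i + i)))

shape : ∀ m → Shape m
shape zero = origin
shape (suc m) with shape m
... | origin     = odd 0
... | odd i      = positive i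
... | positive i = subst Shape (cong suc (double-suc i)) (odd (suc i))

-- Necessity: if c 0 = 1 and all Hankel determinants of c are 1, then c equals its
-- recurrent completion, by strong induction.  The first index where they could differ
-- is some 2n with n ≥ 1; there the completion agrees with c below 2n and is flipped at
-- 2n, so its Hankel determinant of order n + 1 would be 1 + 1 = 0 by hankel-flip,
-- whereas sufficiency makes it 1.
hankel⇒completion : ∀ c → c 0 ≡ true → (∀ n → det₂ (suc n) (hankel c) ≡ true) → ∀ m → completion c m ≡ c m
hankel⇒completion c c₀ hankel-one = <-rec _ agree
  where
  agree : ∀ m → (∀ {k} → k < m → completion c k ≡ c k) → completion c m ≡ c m
  agree m below with shape m
  ... | origin     = sym c₀
  ... | odd i      = completion-odd c i
  ... | positive i with completion c (suc (suc (i + i))) ≟𝔹 c (suc (suc (i + i)))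
  ...   | yes same   = same
  ...   | no differs = ⊥-elim (true≢false (begin
    true                                                          ≡⟨ sym (recurrent⇒hankel (completion c) refl (completion-recurrent c) (suc n)) ⟩
    det₂ (suc n) (hankel (completion c))                          ≡⟨ hankel-flip n c (completion c) below′ corner ⟩
    det₂ (suc n) (hankel c) xor det₂ n (hankel c)                 ≡⟨ cong₂ _xor_ (hankel-one n) (hankel-one i) ⟩
    false                                                         ∎))
    where
    n = suc i
    below′ : ∀ k → k < n + n → completion c k ≡ c k
    below′ k k<2n = below (subst (k <_) (double-suc i) k<2n)
    corner : completion c (n + n) ≡ not (c (n + n))
    corner = subst (λ k → completion c k ≡ not (c k)) (sym (double-suc i)) (¬-not differs)
    true≢false : true ≢ false
    true≢false ()

hankel⇒recurrent : ∀ c → c 0 ≡ true → (∀ n → det₂ (suc n) (hankel c) ≡ true) → Recurrent c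
hankel⇒recurrent c c₀ hankel-one n = begin
  c (suc (n + n)) xor c (suc (suc (n + n)))                        ≡⟨ sym (cong₂ _xor_ (same _) (same _)) ⟩
  completion c (suc (n + n)) xor completion c (suc (suc (n + n)))  ≡⟨ completion-recurrent c n ⟩
  completion c n                                                   ≡⟨ same n ⟩
  c n                                                              ∎
  where
  same : ∀ m → completion c m ≡ c m
  same = hankel⇒completion c c₀ hankel-one

-- Reduction modulo 2, from ℕ and ℤ to F₂.
oddℕ : ℕ → Bool
oddℕ zero    = false
oddℕ (suc n) = not (oddℕ n)

oddℕ-+ : ∀ m n → oddℕ (m + n) ≡ oddℕ m xor oddℕ n
oddℕ-+ zero    n = refl
oddℕ-+ (suc m) n = trans (cong not (oddℕ-+ m n)) (not-distribˡ-xor (oddℕ m) (oddℕ n))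

oddℕ-* : ∀ m n → oddℕ (m * n) ≡ oddℕ m ∧ oddℕ n
oddℕ-* zero    n = refl
oddℕ-* (suc m) n = begin
  oddℕ (n + m * n)                 ≡⟨ oddℕ-+ n (m * n) ⟩
  oddℕ n xor oddℕ (m * n)          ≡⟨ cong (oddℕ n xor_) (oddℕ-* m n) ⟩
  oddℕ n xor (oddℕ m ∧ oddℕ n)     ≡⟨ absorb (oddℕ m) (oddℕ n) ⟩
  not (oddℕ m) ∧ oddℕ n            ∎
  where
  absorb : ∀ a b → b xor (a ∧ b) ≡ not a ∧ b
  absorb false b = xor-identityʳ b
  absorb true  b = xor-same b

oddℕ-⊖ : ∀ m n → oddℕ ∣ m ⊖ n ∣ ≡ oddℕ m xor oddℕ n
oddℕ-⊖ m       zero    = sym (xor-identityʳ (oddℕ m))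
oddℕ-⊖ zero    (suc n) = refl
oddℕ-⊖ (suc m) (suc n) = begin
  oddℕ ∣ suc m ⊖ suc n ∣            ≡⟨ cong (λ z → oddℕ ∣ z ∣) (ℤ.[1+m]⊖[1+n]≡m⊖n m n) ⟩
  oddℕ ∣ m ⊖ n ∣                    ≡⟨ oddℕ-⊖ m n ⟩
  oddℕ m xor oddℕ n                 ≡⟨ sym (xor-annihilates-not (oddℕ m) (oddℕ n)) ⟩
  not (oddℕ m) xor not (oddℕ n)     ∎

oddℤ : ℤ → Bool
oddℤ z = oddℕ ∣ z ∣

oddℤ-+ : ∀ a b → oddℤ (a ℤ.+ b) ≡ oddℤ a xor oddℤ b
oddℤ-+ (+ m)    (+ n)    = oddℕ-+ m n
oddℤ-+ (+ m)    -[1+ n ] = oddℕ-⊖ m (suc n)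
oddℤ-+ -[1+ m ] (+ n)    = trans (oddℕ-⊖ n (suc m)) (xor-comm (oddℕ n) _)
oddℤ-+ -[1+ m ] -[1+ n ] = begin
  not (not (oddℕ (m + n)))        ≡⟨ not-involutive _ ⟩
  oddℕ (m + n)                    ≡⟨ oddℕ-+ m n ⟩
  oddℕ m xor oddℕ n               ≡⟨ sym (xor-annihilates-not (oddℕ m) (oddℕ n)) ⟩
  not (oddℕ m) xor not (oddℕ n)   ∎

oddℤ-* : ∀ a b → oddℤ (a ℤ.* b) ≡ oddℤ a ∧ oddℤ b
oddℤ-* a b = trans (cong oddℕ (ℤ.abs-* a b)) (oddℕ-* ∣ a ∣ ∣ b ∣)

oddℤ-sgn : ∀ k → oddℤ (sgn k) ≡ true
oddℤ-sgn zero          = refl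
oddℤ-sgn (suc zero)    = refl
oddℤ-sgn (suc (suc k)) = oddℤ-sgn k

oddℤ-bit : ∀ b → oddℤ (bit b) ≡ b
oddℤ-bit true  = refl
oddℤ-bit false = refl

%2≡oddℕ : ∀ n → n % 2 ≡ bitℕ (oddℕ n)
%2≡oddℕ zero          = refl
%2≡oddℕ (suc zero)    = refl
%2≡oddℕ (suc (suc n)) = begin
  (2 + n) % 2          ≡⟨ cong (_% 2) (+-comm 2 n) ⟩
  (n + 2) % 2          ≡⟨ [m+n]%n≡m%n n 2 ⟩
  n % 2                ≡⟨ %2≡oddℕ n ⟩
  bitℕ (oddℕ n)        ≡⟨ cong bitℕ (sym (not-involutive (oddℕ n))) ⟩
  bitℕ (oddℕ (2 + n))  ∎

%ℕ2≡oddℤ : ∀ z → z %ℕ 2 ≡ bitℕ (oddℤ z)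
%ℕ2≡oddℤ (+ n) = %2≡oddℕ n
%ℕ2≡oddℤ -[1+ n ] with suc n % 2 | %2≡oddℕ (suc n)
... | zero    | r≡ = r≡
... | suc r   | r≡ = trans (cong (2 Data.Nat.∸_) r≡) (complement (oddℕ (suc n)) r≡)
  where
  complement : ∀ b → suc r ≡ bitℕ b → 2 Data.Nat.∸ bitℕ b ≡ bitℕ b
  complement true  _  = refl
  complement false ()

toℕ-punchIn : ∀ {n} (j : Fin (suc n)) (s : Fin n) → toℕ (punchIn j s) ≡ punch (toℕ j) (toℕ s)
toℕ-punchIn fzero    s        = refl
toℕ-punchIn (fsuc j) fzero    = refl
toℕ-punchIn (fsuc j) (fsuc s) = cong suc (toℕ-punchIn j s)

sumFin-cong : ∀ n {f g : Fin n → ℤ} → (∀ i → f i ≡ g i) → sumFin n f ≡ sumFin n g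
sumFin-cong zero    eq = refl
sumFin-cong (suc n) eq = cong₂ ℤ._+_ (eq fzero) (sumFin-cong n (λ i → eq (fsuc i)))

det-cong : ∀ n {M M′ : Fin n → Fin n → ℤ} → (∀ i j → M i j ≡ M′ i j) → det n M ≡ det n M′
det-cong zero    eq = refl
det-cong (suc n) eq = sumFin-cong (suc n) λ j →
  cong₂ ℤ._*_ (cong (sgn (toℕ j) ℤ.*_) (eq fzero j)) (det-cong n (λ r s → eq (fsuc r) (punchIn j s)))

oddℤ-sumFin : ∀ m (g : ℕ → ℤ) → oddℤ (sumFin m (λ j → g (toℕ j))) ≡ ∑[ k < m ] oddℤ (g k)
oddℤ-sumFin zero    g = refl
oddℤ-sumFin (suc m) g = begin
  oddℤ (g 0 ℤ.+ sumFin m (λ j → g (suc (toℕ j))))   ≡⟨ oddℤ-+ (g 0) _ ⟩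
  oddℤ (g 0) xor oddℤ (sumFin m (λ j → g (suc (toℕ j)))) ≡⟨ cong (oddℤ (g 0) xor_) (oddℤ-sumFin m (λ k → g (suc k))) ⟩
  oddℤ (g 0) xor ∑[ k < m ] oddℤ (g (suc k))       ≡⟨ sym (∑-shift m (λ k → oddℤ (g k))) ⟩
  ∑[ k < suc m ] oddℤ (g k)                         ∎

det-mod2 : ∀ n (f : ℕ → ℕ → ℤ) → oddℤ (det n (λ i j → f (toℕ i) (toℕ j))) ≡ det₂ n (λ r s → oddℤ (f r s))
det-mod2 zero    f = refl
det-mod2 (suc n) f = begin
  oddℤ (det (suc n) (λ i j → f (toℕ i) (toℕ j)))   ≡⟨ cong oddℤ (sumFin-cong (suc n) (λ j → cong (cofactor-sign j ℤ.*_) (det-cong n (λ r s → cong (f (suc (toℕ r))) (toℕ-punchIn j s))))) ⟩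
  oddℤ (sumFin (suc n) (λ j → term (toℕ j)))       ≡⟨ oddℤ-sumFin (suc n) term ⟩
  ∑[ k < suc n ] oddℤ (term k)                      ≡⟨ ∑-ext (suc n) term-mod2 ⟩
  det₂ (suc n) (λ r s → oddℤ (f r s))               ∎
  where
  cofactor-sign : Fin (suc n) → ℤ
  cofactor-sign j = sgn (toℕ j) ℤ.* f 0 (toℕ j)
  term : ℕ → ℤ
  term k = sgn k ℤ.* f 0 k ℤ.* det n (λ r s → f (suc (toℕ r)) (punch k (toℕ s)))
  term-mod2 : ∀ k → oddℤ (term k) ≡ oddℤ (f 0 k) ∧ det₂ n (minor₂ k (λ r s → oddℤ (f r s)))
  term-mod2 k = begin
    oddℤ (term k)                                                        ≡⟨ oddℤ-* (sgn k ℤ.* f 0 k) _ ⟩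
    oddℤ (sgn k ℤ.* f 0 k) ∧ oddℤ (det n (λ r s → f (suc (toℕ r)) (punch k (toℕ s))))
      ≡⟨ cong₂ _∧_ (trans (oddℤ-* (sgn k) (f 0 k)) (cong (_∧ oddℤ (f 0 k)) (oddℤ-sgn k))) (det-mod2 n (λ r s → f (suc r) (punch k s))) ⟩
    oddℤ (f 0 k) ∧ det₂ n (minor₂ k (λ r s → oddℤ (f r s)))              ∎

hankel-mod2 : ∀ c n → H n (λ k → bit (c k)) %ℕ 2 ≡ bitℕ (det₂ n (hankel c))
hankel-mod2 c n = begin
  H n (λ k → bit (c k)) %ℕ 2                            ≡⟨ %ℕ2≡oddℤ (H n (λ k → bit (c k))) ⟩
  bitℕ (oddℤ (H n (λ k → bit (c k))))                   ≡⟨ cong bitℕ (det-mod2 n (λ r s → bit (c (r + s)))) ⟩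
  bitℕ (det₂ n (λ r s → oddℤ (bit (c (r + s)))))        ≡⟨ cong bitℕ (det₂-ext n (λ r s → oddℤ-bit (c (r + s)))) ⟩
  bitℕ (det₂ n (hankel c))                              ∎

bitℕ≡1 : ∀ {b} → bitℕ b ≡ 1 → b ≡ true
bitℕ≡1 {true} _ = refl

bitℕ≡0 : ∀ {b} → bitℕ b ≡ 0 → b ≡ false
bitℕ≡0 {false} _ = refl

apwenian⇔hankel : ∀ c → Apwenian c ⇔ (∀ n → det₂ (suc n) (hankel c) ≡ true)
apwenian⇔hankel c = mk⇔
  (λ apwenian n → bitℕ≡1 (trans (sym (hankel-mod2 c (suc n))) (apwenian n)))
  (λ hankel-one n → trans (hankel-mod2 c (suc n)) (cong bitℕ (hankel-one n)))

bitℕ-sum-mod2 : ∀ a b c → (bitℕ a + bitℕ b + bitℕ c) % 2 ≡ bitℕ (a xor (b xor c))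
bitℕ-sum-mod2 false false false = refl
bitℕ-sum-mod2 false false true  = refl
bitℕ-sum-mod2 false true  false = refl
bitℕ-sum-mod2 false true  true  = refl
bitℕ-sum-mod2 true  false false = refl
bitℕ-sum-mod2 true  false true  = refl
bitℕ-sum-mod2 true  true  false = refl
bitℕ-sum-mod2 true  true  true  = refl

2n+1≡1+n+n : ∀ n → 2 * n + 1 ≡ suc (n + n)
2n+1≡1+n+n n = trans (+-comm (2 * n) 1) (cong (λ k → suc (n + k)) (+-identityʳ n))

2n+2≡2+n+n : ∀ n → 2 * n + 2 ≡ suc (suc (n + n))
2n+2≡2+n+n n = trans (+-comm (2 * n) 2) (cong (λ k → suc (suc (n + k))) (+-identityʳ n))

condition⇔recurrence : ∀ (c : ℕ → Bool) n →
  ((bitℕ (c n) + bitℕ (c (2 * n + 1)) + bitℕ (c (2 * n + 2))) % 2 ≡ 0) ⇔ (c (suc (n + n)) xor c (suc (suc (n + n))) ≡ c n)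
condition⇔recurrence c n = mk⇔
  (λ even-sum → sym (xor≡false⇒≡ (bitℕ≡0 (trans (sym parity) even-sum))))
  (λ rec → trans parity (cong bitℕ (trans (cong (c n xor_) rec) (xor-same (c n)))))
  where
  parity : (bitℕ (c n) + bitℕ (c (2 * n + 1)) + bitℕ (c (2 * n + 2))) % 2 ≡ bitℕ (c n xor (c (suc (n + n)) xor c (suc (suc (n + n)))))
  parity = trans (bitℕ-sum-mod2 (c n) _ _) (cong₂ (λ i j → bitℕ (c n xor (c i xor c j))) (2n+1≡1+n+n n) (2n+2≡2+n+n n))

theorem1p5 : (c : ℕ → Bool) → c 0 ≡ true →
    (Apwenian c ⇔ (∀ n → (bitℕ (c n) + bitℕ (c (2 * n + 1)) + bitℕ (c (2 * n + 2))) % 2 ≡ 0))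
theorem1p5 c c₀ = mk⇔
  (λ apwenian n → Equivalence.from (condition⇔recurrence c n)
                    (hankel⇒recurrent c c₀ (Equivalence.to (apwenian⇔hankel c) apwenian) n))
  (λ condition → Equivalence.from (apwenian⇔hankel c)
                    (λ n → recurrent⇒hankel c c₀ (λ m → Equivalence.to (condition⇔recurrence c m) (condition m)) (suc n)))
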